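{- For every $n\in\mathbb{N}$, $8^{n^2} \ge (n+1)^{n+2}$. -}

module Defs where

{-# OPTIONS --safe #-}
module Submission where

open import Defs
open import Data.Nat using (ℕ; zero; suc; _^_; _*_; _+_; _≥_; _≤_; _<_; z≤n; s≤s)
open import Data.Nat.Properties
open import Relation.Binary.PropositionalEquality using (sym; cong)

n<2^n : ∀ n → n < 2 ^ n
n<2^n zero    = s≤s z≤n
n<2^n (suc n) = begin-strict
  suc n         <⟨ s≤s (n<2^n n) ⟩
  suc (2 ^ n)   ≤⟨ +-monoˡ-≤ (2 ^ n) (m^n>0 2 n) ⟩
  2 ^ n + 2 ^ n ≡⟨ cong (2 ^ n +_) (sym (+-identityʳ (2 ^ n))) ⟩
  2 ^ suc n     ∎
  where open ≤-Reasoning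

[n+1]^k≤2^[n*k] : ∀ n k → (n + 1) ^ k ≤ 2 ^ (n * k)
[n+1]^k≤2^[n*k] n k = begin
  (n + 1) ^ k   ≡⟨ cong (_^ k) (+-comm n 1) ⟩
  suc n ^ k     ≤⟨ ^-monoˡ-≤ k (n<2^n n) ⟩
  (2 ^ n) ^ k   ≡⟨ ^-*-assoc 2 n k ⟩
  2 ^ (n * k)   ∎
  where open ≤-Reasoning

n≤n*n : ∀ n → n ≤ n * n
n≤n*n zero      = z≤n
n≤n*n n@(suc _) = m≤m*n n n

n*[n+k]≤[1+k]*[n*n] : ∀ n k → n * (n + k) ≤ suc k * (n * n)
n*[n+k]≤[1+k]*[n*n] n k = begin
  n * (n + k)       ≡⟨ *-distribˡ-+ n n k ⟩
  n * n + n * k     ≡⟨ cong (n * n +_) (*-comm n k) ⟩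
  n * n + k * n     ≤⟨ +-monoʳ-≤ (n * n) (*-monoʳ-≤ k (n≤n*n n)) ⟩
  suc k * (n * n)   ∎
  where open ≤-Reasoning

mainTheorem7 : (n : ℕ) → 8 ^ (n * n) ≥ (n + 1) ^ (n + 2)
mainTheorem7 n = begin
  (n + 1) ^ (n + 2)   ≤⟨ [n+1]^k≤2^[n*k] n (n + 2) ⟩
  2 ^ (n * (n + 2))   ≤⟨ ^-monoʳ-≤ 2 (n*[n+k]≤[1+k]*[n*n] n 2) ⟩
  2 ^ (3 * (n * n))   ≡⟨ ^-*-assoc 2 3 (n * n) ⟨
  8 ^ (n * n)         ∎
  where open ≤-Reasoning
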